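{- Let $T$ be a rooted tree (arborescence) containing some terminals, and let $\phi\ge 1$. Then $T$ contains a $\phi$-core of size at most $\lceil \ell(T)/\phi\rceil$, where $\ell(T)$ denotes the number of terminals in $T$.
   Context: A set $C$ of vertices is a $\phi$-core of a tree $T$ if there is a collection of edge-disjoint subtrees $T_1,T_2,\ldots$ of $T$ such that: (a) the root of each $T_i$ is in $C$; (b) every terminal in $T$ is contained in exactly one $T_i$; (c) each $T_i$ contains at most $\phi$ terminals. Terminals are assumed to be leaves. -}

module Defs where

open import Data.Nat using (ℕ; zero; suc; _+_; _∸_; _≤_; _<_; NonZero)
open import Data.Nat.DivMod using (_/_)
open import Data.Fin using (Fin; zero; suc; toℕ)
open import Data.Fin.Subset using (Subset; _∈_; _∉_; ∣_∣; _∩_)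
open import Data.Product using (Σ; _×_; _,_)
open import Relation.Binary.PropositionalEquality using (_≡_; _≢_)
open import Relation.Nullary using (¬_)

-- Vertex 0 is the root; the non-root vertex (suc i) has parent (parent i).
-- Vertices are numbered in a topological order (parents before children),
-- which every rooted tree admits; this guarantees acyclicity.
-- The edges are in bijection with the non-root vertices: edge i joins
-- (suc i) to (parent i).
record RootedTree (n : ℕ) : Set where
  field
    parent     : Fin n → Fin (suc n)
    parent-lt  : (i : Fin n) → toℕ (parent i) ≤ toℕ i

open RootedTree public

IsLeaf : ∀ {n} → RootedTree n → Fin (suc n) → Set
IsLeaf {n} T v = (i : Fin n) → parent T i ≢ v

record Subtree {n : ℕ} (T : RootedTree n) : Set where
  field
    verts    : Subset (suc n)
    root     : Fin (suc n)
    root∈    : root ∈ verts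
    closed₀  : zero ∈ verts → zero ≡ root
    closedₛ  : (i : Fin n) → suc i ∈ verts → suc i ≢ root → parent T i ∈ verts

open Subtree public

EdgeIn : ∀ {n} {T : RootedTree n} → Subtree T → Fin n → Set
EdgeIn S i = (suc i ∈ verts S) × (suc i ≢ root S)

termCount : ∀ {n} {T : RootedTree n} → Subset (suc n) → Subtree T → ℕ
termCount term S = ∣ verts S ∩ term ∣

IsCore : ∀ {n} (T : RootedTree n) (term : Subset (suc n)) (φ : ℕ) → Subset (suc n) → Set
IsCore {n} T term φ C =
  Σ ℕ λ k → Σ (Fin k → Subtree T) λ Ts →
      ((j j' : Fin k) → j ≢ j' → (e : Fin n) → ¬ (EdgeIn (Ts j) e × EdgeIn (Ts j') e))
    × ((j : Fin k) → root (Ts j) ∈ C)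
    × ((v : Fin (suc n)) → v ∈ term →
         Σ (Fin k) λ j → (v ∈ verts (Ts j)) × ((j' : Fin k) → v ∈ verts (Ts j') → j' ≡ j))
    × ((j : Fin k) → termCount term (Ts j) ≤ φ)

⌈_/_⌉ : (m φ : ℕ) → .{{NonZero φ}} → ℕ
⌈ m / φ ⌉ = (m + φ ∸ 1) / φ

-- Let c = φ + 1 be the capacity, and call a vertex heavy if at least c terminals lie
-- below it, or all of them do; the root is heavy.  Take a deepest heavy vertex v (in the
-- topological numbering).  Every child of v is light, so the branches of v through its
-- children, pruned to the vertices above terminals and all rooted at v, carry at most c
-- terminals each and cover the terminals below v with the single core vertex v (if v is
-- itself a terminal, it is a leaf and forms a tree on its own).  Recursing on the other
-- terminals yields pruned trees that avoid the subtree of v altogether, so the two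
-- packings are edge-disjoint.  Since at least c terminals, or all of them, were removed,
-- adding v keeps the core within ⌈ℓ / c⌉.

module Submission where

open import Defs
open import Data.Nat using (ℕ; suc; _≤_)
open import Data.Fin using (Fin)
open import Data.Fin.Subset using (Subset; _∈_; ∣_∣)
open import Data.Product using (Σ; _×_)

open import Level using (0ℓ)
open import Function using (_∘_; id; _on_; _↔_; Inverse)
open import Data.Bool using (true; false)
open import Data.Empty using (⊥-elim)
open import Data.Sum using (_⊎_; inj₁; inj₂; [_,_]′)
open import Data.Product using (_,_; proj₁; proj₂; ∃; ∃-syntax)
open import Data.Nat as ℕ using (_+_; _∸_; _<_; _≤?_; z≤n; s≤s; NonZero)
import Data.Nat.Properties as ℕ
open import Data.Nat.Divisibility using (∣-refl)
open import Data.Nat.DivMod using (_/_; /-congˡ; /-monoˡ-≤; n/n≡1; +-distrib-/-∣ʳ; m≥n⇒m/n>0; m<n⇒m/n≡0)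
open import Data.Nat.Induction using (<-wellFounded)
open import Data.Fin as Fin using (zero; suc; toℕ; _≟_)
open import Data.Fin.Properties using (any?; +↔⊎)
import Data.Fin.Induction as Fin
open import Data.Fin.Subset using (_∉_; _⊆_; _∩_; _∪_; _─_; ⁅_⁆; Nonempty; Empty) renaming (⊥ to ∅)
open import Data.Fin.Subset.Properties
  using (_∈?_; _⊆?_; nonempty?; ∣⊥∣≡0; ∣⁅x⁆∣≡1; x∈⁅x⁆; x∈⁅y⁆⇒x≡y; x∈p∩q⁺; x∈p∩q⁻;
         x∈p∪q⁺; x∈p∪q⁻; Empty-unique; p⊆q⇒∣p∣≤∣q∣; ∣p∩q∣≤∣p∣; p─q⊆p; p∩q≢∅⇒∣p─q∣<∣p∣; x∈p⇒∣p-x∣<∣p∣)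
open import Data.Vec using (_∷_; []; tabulate; here; there)
open import Data.Vec.Properties using (lookup∘tabulate; []=⇒lookup; lookup⇒[]=)
open import Relation.Nullary using (¬_; Dec; yes; no; does)
open import Relation.Nullary.Decidable using (dec-true; map′; _×-dec_; _⊎-dec_)
open import Relation.Unary using (Pred; Decidable)
open import Relation.Binary.PropositionalEquality using (_≡_; _≢_; refl; sym; trans; cong; subst; module ≡-Reasoning)
open import Relation.Binary.Construct.On as On using ()
open import Induction.WellFounded using (WfRec; module All)

greatest : ∀ {m} {P : Pred (Fin m) 0ℓ} → Decidable P → ∀ {x} → P x →
           ∃[ v ] P v × (∀ y → toℕ v < toℕ y → ¬ P y)
greatest {suc m} P? {x} px with any? (P? ∘ suc)
... | yes (y , py) with greatest (P? ∘ suc) py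
...   | v , pv , above = suc v , pv , λ { zero () ; (suc y) (s≤s v<y) → above y v<y }
greatest {suc m} P? {zero} px | no none = zero , px , λ { (suc y) _ → none ∘ (y ,_) }
greatest {suc m} P? {suc x} px | no none = ⊥-elim (none (x , px))

module _ {m} {P : Pred (Fin m) 0ℓ} (P? : Decidable P) where

  select : Subset m
  select = tabulate (does ∘ P?)

  ∈select⁺ : ∀ {x} → P x → x ∈ select
  ∈select⁺ {x} px = lookup⇒[]= x select (trans (lookup∘tabulate _ x) (dec-true (P? x) px))

  ∈select⁻ : ∀ {x} → x ∈ select → P x
  ∈select⁻ {x} x∈ with P? x | trans (sym (lookup∘tabulate (does ∘ P?) x)) ([]=⇒lookup x∈)
  ... | yes px | _  = px
  ... | no _   | ()

x∈p─q⇒x∉q : ∀ {m} (p q : Subset m) {x} → x ∈ p ─ q → x ∉ q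
x∈p─q⇒x∉q (true ∷ p) (false ∷ q) here ()
x∈p─q⇒x∉q (_ ∷ p) (_ ∷ q) (there x∈) (there x∈′) = x∈p─q⇒x∉q p q x∈ x∈′

p∩q∪p─q≡p : ∀ {m} (p q : Subset m) → (p ∩ q) ∪ (p ─ q) ≡ p
p∩q∪p─q≡p []          []          = refl
p∩q∪p─q≡p (true ∷ p)  (true ∷ q)  = cong (true ∷_) (p∩q∪p─q≡p p q)
p∩q∪p─q≡p (true ∷ p)  (false ∷ q) = cong (true ∷_) (p∩q∪p─q≡p p q)
p∩q∪p─q≡p (false ∷ p) (true ∷ q)  = cong (false ∷_) (p∩q∪p─q≡p p q)
p∩q∪p─q≡p (false ∷ p) (false ∷ q) = cong (false ∷_) (p∩q∪p─q≡p p q)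

∣p∩q∣+∣p─q∣≡∣p∣ : ∀ {m} (p q : Subset m) → ∣ p ∩ q ∣ + ∣ p ─ q ∣ ≡ ∣ p ∣
∣p∩q∣+∣p─q∣≡∣p∣ []          []          = refl
∣p∩q∣+∣p─q∣≡∣p∣ (true ∷ p)  (true ∷ q)  = cong suc (∣p∩q∣+∣p─q∣≡∣p∣ p q)
∣p∩q∣+∣p─q∣≡∣p∣ (true ∷ p)  (false ∷ q) = trans (ℕ.+-suc _ _) (cong suc (∣p∩q∣+∣p─q∣≡∣p∣ p q))
∣p∩q∣+∣p─q∣≡∣p∣ (false ∷ p) (true ∷ q)  = ∣p∩q∣+∣p─q∣≡∣p∣ p q
∣p∩q∣+∣p─q∣≡∣p∣ (false ∷ p) (false ∷ q) = ∣p∩q∣+∣p─q∣≡∣p∣ p q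

∣p∪q∣≤∣p∣+∣q∣ : ∀ {m} (p q : Subset m) → ∣ p ∪ q ∣ ≤ ∣ p ∣ + ∣ q ∣
∣p∪q∣≤∣p∣+∣q∣ []          []          = z≤n
∣p∪q∣≤∣p∣+∣q∣ (true ∷ p)  (true ∷ q)  = s≤s (ℕ.≤-trans (∣p∪q∣≤∣p∣+∣q∣ p q) (ℕ.+-monoʳ-≤ ∣ p ∣ (ℕ.n≤1+n _)))
∣p∪q∣≤∣p∣+∣q∣ (true ∷ p)  (false ∷ q) = s≤s (∣p∪q∣≤∣p∣+∣q∣ p q)
∣p∪q∣≤∣p∣+∣q∣ (false ∷ p) (true ∷ q)  = subst (suc ∣ p ∪ q ∣ ≤_) (sym (ℕ.+-suc _ _)) (s≤s (∣p∪q∣≤∣p∣+∣q∣ p q))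
∣p∪q∣≤∣p∣+∣q∣ (false ∷ p) (false ∷ q) = ∣p∪q∣≤∣p∣+∣q∣ p q

Nonempty⇒∣p∣>0 : ∀ {m} {p : Subset m} → Nonempty p → 0 < ∣ p ∣
Nonempty⇒∣p∣>0 (x , x∈p) = ℕ.≤-trans (s≤s z≤n) (x∈p⇒∣p-x∣<∣p∣ x∈p)

Empty⇒∣p∣≡0 : ∀ {m} {p : Subset m} → Empty p → ∣ p ∣ ≡ 0
Empty⇒∣p∣≡0 {m} empty = trans (cong ∣_∣ (Empty-unique empty)) (∣⊥∣≡0 m)

∣p∣>0⇒Nonempty : ∀ {m} {p : Subset m} → 0 < ∣ p ∣ → Nonempty p
∣p∣>0⇒Nonempty {p = p} ∣p∣>0 with nonempty? p
... | yes p≢∅ = p≢∅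
... | no p≡∅  = ⊥-elim (ℕ.n>0⇒n≢0 ∣p∣>0 (Empty⇒∣p∣≡0 p≡∅))

∣p∩q∣≤∣r∩s∣ : ∀ {m} {p q r s : Subset m} → (∀ {x} → x ∈ p → x ∈ q → x ∈ r × x ∈ s) → ∣ p ∩ q ∣ ≤ ∣ r ∩ s ∣
∣p∩q∣≤∣r∩s∣ {p = p} {q} sub = p⊆q⇒∣p∣≤∣q∣ λ x∈p∩q → let (x∈p , x∈q) = x∈p∩q⁻ p q x∈p∩q in x∈p∩q⁺ (sub x∈p x∈q)

⌈m/n⌉-mono-≤ : ∀ {m m′} n .{{_ : NonZero n}} → m ≤ m′ → ⌈ m / n ⌉ ≤ ⌈ m′ / n ⌉
⌈m/n⌉-mono-≤ n m≤m′ = /-monoˡ-≤ n (ℕ.∸-monoˡ-≤ 1 (ℕ.+-monoˡ-≤ n m≤m′))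

⌈0/n⌉≡0 : ∀ n .{{_ : NonZero n}} → ⌈ 0 / n ⌉ ≡ 0
⌈0/n⌉≡0 (suc n) = m<n⇒m/n≡0 (ℕ.n<1+n n)

⌈m/n⌉>0 : ∀ {m} n .{{_ : NonZero n}} → 0 < m → 0 < ⌈ m / n ⌉
⌈m/n⌉>0 {suc m} n _ = m≥n⇒m/n>0 (ℕ.m≤n+m n m)

⌈m+n/n⌉≡1+⌈m/n⌉ : ∀ m n .{{_ : NonZero n}} → ⌈ m + n / n ⌉ ≡ suc ⌈ m / n ⌉
⌈m+n/n⌉≡1+⌈m/n⌉ m n = begin
  (m + n + n ∸ 1) / n         ≡⟨ /-congˡ (ℕ.+-∸-comm n (ℕ.≤-trans (ℕ.>-nonZero⁻¹ n) (ℕ.m≤n+m n m))) ⟩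
  (m + n ∸ 1 + n) / n         ≡⟨ +-distrib-/-∣ʳ (m + n ∸ 1) ∣-refl ⟩
  ⌈ m / n ⌉ + n / n           ≡⟨ cong (⌈ m / n ⌉ +_) (n/n≡1 n) ⟩
  ⌈ m / n ⌉ + 1               ≡⟨ ℕ.+-comm _ 1 ⟩
  suc ⌈ m / n ⌉               ∎
  where open ≡-Reasoning

⌈m/n⌉-split : ∀ a b n .{{_ : NonZero n}} → 0 < b → n ≤ b ⊎ a ≡ 0 → suc ⌈ a / n ⌉ ≤ ⌈ b + a / n ⌉
⌈m/n⌉-split a b n _   (inj₁ n≤b) = begin
  suc ⌈ a / n ⌉     ≡⟨ ⌈m+n/n⌉≡1+⌈m/n⌉ a n ⟨
  ⌈ a + n / n ⌉     ≤⟨ ⌈m/n⌉-mono-≤ n (ℕ.≤-trans (ℕ.+-monoʳ-≤ a n≤b) (ℕ.≤-reflexive (ℕ.+-comm a b))) ⟩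
  ⌈ b + a / n ⌉     ∎
  where open ℕ.≤-Reasoning
⌈m/n⌉-split a b n b>0 (inj₂ refl) = begin
  suc ⌈ 0 / n ⌉     ≡⟨ cong suc (⌈0/n⌉≡0 n) ⟩
  1                 ≤⟨ ⌈m/n⌉>0 n b>0 ⟩
  ⌈ b / n ⌉         ≡⟨ cong (λ b′ → ⌈ b′ / n ⌉) (ℕ.+-identityʳ b) ⟨
  ⌈ b + 0 / n ⌉     ∎
  where open ℕ.≤-Reasoning

module Ancestry {n : ℕ} (T : RootedTree n) where

  Vertex : Set
  Vertex = Fin (suc n)

  parent<suc : ∀ i → parent T i Fin.< suc i
  parent<suc i = s≤s (parent-lt T i)

  parent-rec : (P : Vertex → Set) → P zero → (∀ i → P (parent T i) → P (suc i)) → ∀ v → P v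
  parent-rec P P-root P-child = All.wfRec Fin.<-wellFounded 0ℓ P step
    where
    step : ∀ v → WfRec Fin._<_ P v → P v
    step zero    _  = P-root
    step (suc i) IH = P-child i (IH (parent<suc i))

  infix 4 _≼_ _≼?_

  data _≼_ (x : Vertex) : Vertex → Set where
    ≼-refl : x ≼ x
    ≼-step : ∀ {i} → x ≼ parent T i → x ≼ suc i

  ≼⇒toℕ≤ : ∀ {x y} → x ≼ y → toℕ x ≤ toℕ y
  ≼⇒toℕ≤ ≼-refl = ℕ.≤-refl
  ≼⇒toℕ≤ (≼-step {i} x≼p) = ℕ.≤-trans (≼⇒toℕ≤ x≼p) (ℕ.<⇒≤ (parent<suc i))

  ≼-trans : ∀ {x y z} → x ≼ y → y ≼ z → x ≼ z
  ≼-trans x≼y ≼-refl       = x≼y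
  ≼-trans x≼y (≼-step y≼p) = ≼-step (≼-trans x≼y y≼p)

  ≼-step⁻ : ∀ {x i} → x ≼ suc i → x ≡ suc i ⊎ x ≼ parent T i
  ≼-step⁻ ≼-refl       = inj₁ refl
  ≼-step⁻ (≼-step x≼p) = inj₂ x≼p

  ≼-zero⁻ : ∀ {x} → x ≼ zero → x ≡ zero
  ≼-zero⁻ ≼-refl = refl

  zero≼ : ∀ y → zero ≼ y
  zero≼ = parent-rec (zero ≼_) ≼-refl (λ _ → ≼-step)

  _≼?_ : ∀ x y → Dec (x ≼ y)
  x ≼? y = parent-rec (λ y → Dec (x ≼ y)) at-root at-child y
    where
    at-root : Dec (x ≼ zero)
    at-root = map′ (λ { refl → ≼-refl }) ≼-zero⁻ (x ≟ zero)
    at-child : ∀ i → Dec (x ≼ parent T i) → Dec (x ≼ suc i)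
    at-child i x≼?p with x ≟ suc i
    ... | yes refl = yes ≼-refl
    ... | no x≢i   = map′ ≼-step (λ x≼i → [ ⊥-elim ∘ x≢i , id ]′ (≼-step⁻ x≼i)) x≼?p

  ≼-leaf : ∀ {x y} → IsLeaf T x → x ≼ y → y ≡ x
  ≼-leaf leaf ≼-refl       = refl
  ≼-leaf leaf (≼-step x≼p) = ⊥-elim (leaf _ (≼-leaf leaf x≼p))

  ≼-connex-above : ∀ {x y z} → x ≼ z → y ≼ z → x ≼ y ⊎ y ≼ x
  ≼-connex-above ≼-refl       y≼z          = inj₂ y≼z
  ≼-connex-above (≼-step x≼p) ≼-refl       = inj₁ (≼-step x≼p)
  ≼-connex-above (≼-step x≼p) (≼-step y≼p) = ≼-connex-above x≼p y≼p

  ChildOf : Vertex → Vertex → Set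
  ChildOf v w = ∃[ i ] w ≡ suc i × parent T i ≡ v

  childOf? : ∀ v → Decidable (ChildOf v)
  childOf? v zero    = no λ { (_ , () , _) }
  childOf? v (suc i) = map′ (λ p≡v → i , refl , p≡v) (λ { (_ , refl , p≡v) → p≡v }) (parent T i ≟ v)

  child≼ : ∀ {v w} → ChildOf v w → v ≼ w
  child≼ (_ , refl , refl) = ≼-step ≼-refl

  child⇒toℕ< : ∀ {v w} → ChildOf v w → toℕ v < toℕ w
  child⇒toℕ< (i , refl , refl) = parent<suc i

  child-on-path : ∀ {v y} → v ≼ y → y ≢ v → ∃[ w ] ChildOf v w × w ≼ y
  child-on-path ≼-refl y≢v = ⊥-elim (y≢v refl)
  child-on-path {v} (≼-step {i} v≼p) y≢v with parent T i ≟ v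
  ... | yes p≡v = suc i , (i , refl , p≡v) , ≼-refl
  ... | no p≢v with child-on-path v≼p p≢v
  ...   | w , w-child , w≼p = w , w-child , ≼-step w≼p

  child≼child⇒≡ : ∀ {v w w′} → ChildOf v w → ChildOf v w′ → w ≼ w′ → w ≡ w′
  child≼child⇒≡ _ _ ≼-refl = refl
  child≼child⇒≡ (i , refl , refl) (_ , refl , p≡v) (≼-step w≼p) = ⊥-elim (ℕ.<-irrefl refl
    (ℕ.≤-trans (≼⇒toℕ≤ w≼p) (ℕ.≤-trans (ℕ.≤-reflexive (cong toℕ p≡v)) (parent-lt T i))))

  child-unique : ∀ {v w w′ y} → ChildOf v w → ChildOf v w′ → w ≼ y → w′ ≼ y → w ≡ w′
  child-unique w-child w′-child w≼y w′≼y with ≼-connex-above w≼y w′≼y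
  ... | inj₁ w≼w′ = child≼child⇒≡ w-child w′-child w≼w′
  ... | inj₂ w′≼w = sym (child≼child⇒≡ w′-child w-child w′≼w)

  below : Vertex → Subset (suc n)
  below v = select (v ≼?_)

  HasTerminalBelow : Subset (suc n) → Vertex → Set
  HasTerminalBelow term x = ∃[ t ] t ∈ term × x ≼ t

  HasTerminalBelow-mono : ∀ {term term′ x} → term ⊆ term′ → HasTerminalBelow term x → HasTerminalBelow term′ x
  HasTerminalBelow-mono sub (t , t∈ , x≼t) = t , sub t∈ , x≼t

  hasTerminalBelow? : ∀ term → Decidable (HasTerminalBelow term)
  hasTerminalBelow? term x = any? (λ t → (t ∈? term) ×-dec (x ≼? t))

  subtreeFrom : {P : Pred Vertex 0ℓ} (P? : Decidable P) (r : Vertex) → P r → (∀ {x} → P x → r ≼ x)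
              → (∀ i → P (suc i) → suc i ≢ r → P (parent T i)) → Subtree T
  subtreeFrom P? r Pr r≼ closed = record
    { verts   = select P?
    ; root    = r
    ; root∈   = ∈select⁺ P? Pr
    ; closed₀ = λ 0∈ → sym (≼-zero⁻ (r≼ (∈select⁻ P? 0∈)))
    ; closedₛ = λ i i∈ i≢r → ∈select⁺ P? (closed i (∈select⁻ P? i∈) i≢r)
    }

  module Branches (v : Vertex) (term : Subset (suc n)) where

    -- Branches are indexed by all vertices w; unless w is a child of v, the branch is just v.
    InBranch : Vertex → Vertex → Set
    InBranch w x = x ≡ v ⊎ ChildOf v w × w ≼ x × HasTerminalBelow term x

    inBranch? : ∀ w → Decidable (InBranch w)
    inBranch? w x = (x ≟ v) ⊎-dec (childOf? v w ×-dec (w ≼? x) ×-dec hasTerminalBelow? term x)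

    inBranch⇒v≼ : ∀ {w x} → InBranch w x → v ≼ x
    inBranch⇒v≼ (inj₁ refl)               = ≼-refl
    inBranch⇒v≼ (inj₂ (w-child , w≼x , _)) = ≼-trans (child≼ w-child) w≼x

    inBranch-closed : ∀ w i → InBranch w (suc i) → suc i ≢ v → InBranch w (parent T i)
    inBranch-closed w i (inj₁ i≡v) i≢v = ⊥-elim (i≢v i≡v)
    inBranch-closed _ i (inj₂ ((_ , refl , p≡v) , ≼-refl , _)) _ = inj₁ p≡v
    inBranch-closed w i (inj₂ (w-child , ≼-step w≼p , t , t∈ , i≼t)) _ =
      inj₂ (w-child , w≼p , t , t∈ , ≼-trans (≼-step ≼-refl) i≼t)

    branch : Vertex → Subtree T
    branch w = subtreeFrom (inBranch? w) v (inj₁ refl) inBranch⇒v≼ (inBranch-closed w)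

module Packings {n : ℕ} (T : RootedTree n) (κ : ℕ) where
  open Ancestry T

  record Packing (I : Set) (term C : Subset (suc n)) : Set where
    field
      tree          : I → Subtree T
      edge-disjoint : ∀ i j → i ≢ j → ∀ e → ¬ (EdgeIn (tree i) e × EdgeIn (tree j) e)
      root∈C        : ∀ i → root (tree i) ∈ C
      cover         : ∀ t → t ∈ term → ∃[ i ] t ∈ verts (tree i) × (∀ j → t ∈ verts (tree j) → j ≡ i)
      capacity      : ∀ i → termCount term (tree i) ≤ κ
      pruned        : ∀ i {x} → x ∈ verts (tree i) → HasTerminalBelow term x

  packing⇒core : ∀ {k term C} → Packing (Fin k) term C → IsCore T term κ C
  packing⇒core {k} P = k , tree , edge-disjoint , root∈C , cover , capacity
    where open Packing P

  reindex : ∀ {I J term C} → J ↔ I → Packing I term C → Packing J term C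
  reindex {term = term} J↔I P = record
    { tree          = tree ∘ to
    ; edge-disjoint = λ j j′ j≢j′ → edge-disjoint (to j) (to j′) (j≢j′ ∘ to-injective)
    ; root∈C        = root∈C ∘ to
    ; cover         = cover′
    ; capacity      = capacity ∘ to
    ; pruned        = pruned ∘ to
    }
    where
    open Packing P
    open Inverse J↔I
    to-injective : ∀ {j j′} → to j ≡ to j′ → j ≡ j′
    to-injective {j} {j′} eq = trans (sym (strictlyInverseʳ j)) (trans (cong from eq) (strictlyInverseʳ j′))
    cover′ : ∀ t → t ∈ term → ∃[ j ] t ∈ verts (tree (to j)) × (∀ j′ → t ∈ verts (tree (to j′)) → j′ ≡ j)
    cover′ t t∈ with cover t t∈
    ... | i , t∈i , unique = from i , subst (λ i → t ∈ verts (tree i)) (sym (strictlyInverseˡ i)) t∈i ,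
                             λ j t∈j → trans (sym (strictlyInverseʳ j)) (cong from (unique (to j) t∈j))

  ∪-packing : ∀ {I J term₁ term₂ C₁ C₂} (P : Packing I term₁ C₁) (Q : Packing J term₂ C₂)
            → (∀ i j {x} → x ∈ verts (Packing.tree P i) → x ∉ verts (Packing.tree Q j))
            → Packing (I ⊎ J) (term₁ ∪ term₂) (C₁ ∪ C₂)
  ∪-packing {I} {J} {term₁} {term₂} {C₁} {C₂} P Q apart = record
    { tree          = tree
    ; edge-disjoint = edge-disjoint
    ; root∈C        = root∈C
    ; cover         = cover
    ; capacity      = capacity
    ; pruned        = pruned
    }
    where
    module P = Packing P
    module Q = Packing Q

    tree : I ⊎ J → Subtree T
    tree = [ P.tree , Q.tree ]′

    edge-disjoint : ∀ i j → i ≢ j → ∀ e → ¬ (EdgeIn (tree i) e × EdgeIn (tree j) e)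
    edge-disjoint (inj₁ i) (inj₁ i′) i≢i′ = P.edge-disjoint i i′ (i≢i′ ∘ cong inj₁)
    edge-disjoint (inj₁ i) (inj₂ j)  _ e ((e∈i , _) , (e∈j , _)) = apart i j e∈i e∈j
    edge-disjoint (inj₂ j) (inj₁ i)  _ e ((e∈j , _) , (e∈i , _)) = apart i j e∈i e∈j
    edge-disjoint (inj₂ j) (inj₂ j′) j≢j′ = Q.edge-disjoint j j′ (j≢j′ ∘ cong inj₂)

    root∈C : ∀ i → root (tree i) ∈ C₁ ∪ C₂
    root∈C (inj₁ i) = x∈p∪q⁺ (inj₁ (P.root∈C i))
    root∈C (inj₂ j) = x∈p∪q⁺ (inj₂ (Q.root∈C j))

    cover : ∀ t → t ∈ term₁ ∪ term₂ → ∃[ i ] t ∈ verts (tree i) × (∀ j → t ∈ verts (tree j) → j ≡ i)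
    cover t t∈ with x∈p∪q⁻ term₁ term₂ t∈
    ... | inj₁ t∈₁ with P.cover t t∈₁
    ...   | i , t∈i , unique = inj₁ i , t∈i , λ
      { (inj₁ i′) t∈i′ → cong inj₁ (unique i′ t∈i′)
      ; (inj₂ j)  t∈j  → ⊥-elim (apart i j t∈i t∈j) }
    cover t t∈ | inj₂ t∈₂ with Q.cover t t∈₂
    ...   | j , t∈j , unique = inj₂ j , t∈j , λ
      { (inj₁ i)  t∈i  → ⊥-elim (apart i j t∈i t∈j)
      ; (inj₂ j′) t∈j′ → cong inj₂ (unique j′ t∈j′) }

    capacity : ∀ i → termCount (term₁ ∪ term₂) (tree i) ≤ κ
    capacity (inj₁ i) = ℕ.≤-trans (∣p∩q∣≤∣r∩s∣ only₁) (P.capacity i)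
      where
      only₁ : ∀ {x} → x ∈ verts (P.tree i) → x ∈ term₁ ∪ term₂ → x ∈ verts (P.tree i) × x ∈ term₁
      only₁ {x} x∈i x∈ with x∈p∪q⁻ term₁ term₂ x∈
      ... | inj₁ x∈₁ = x∈i , x∈₁
      ... | inj₂ x∈₂ with Q.cover x x∈₂
      ...   | j , x∈j , _ = ⊥-elim (apart i j x∈i x∈j)
    capacity (inj₂ j) = ℕ.≤-trans (∣p∩q∣≤∣r∩s∣ only₂) (Q.capacity j)
      where
      only₂ : ∀ {x} → x ∈ verts (Q.tree j) → x ∈ term₁ ∪ term₂ → x ∈ verts (Q.tree j) × x ∈ term₂
      only₂ {x} x∈j x∈ with x∈p∪q⁻ term₁ term₂ x∈
      ... | inj₂ x∈₂ = x∈j , x∈₂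
      ... | inj₁ x∈₁ with P.cover x x∈₁
      ...   | i , x∈i , _ = ⊥-elim (apart i j x∈i x∈j)

    pruned : ∀ i {x} → x ∈ verts (tree i) → HasTerminalBelow (term₁ ∪ term₂) x
    pruned (inj₁ i) = HasTerminalBelow-mono (x∈p∪q⁺ ∘ inj₁) ∘ P.pruned i
    pruned (inj₂ j) = HasTerminalBelow-mono (x∈p∪q⁺ ∘ inj₂) ∘ Q.pruned j

  Below : ∀ {I term C} → Vertex → Packing I term C → Set
  Below v P = ∀ i {x} → x ∈ verts (Packing.tree P i) → v ≼ x

  attach : ∀ {I J term C} v (P : Packing I (term ∩ below v) ⁅ v ⁆) → Below v P
         → Packing J (term ─ below v) C → Packing (I ⊎ J) term (⁅ v ⁆ ∪ C)
  attach {term = term} v P P-below Q =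
    subst (λ term → Packing _ term _) (p∩q∪p─q≡p term (below v)) (∪-packing P Q apart)
    where
    apart : ∀ i j {x} → x ∈ verts (Packing.tree P i) → x ∉ verts (Packing.tree Q j)
    apart i j x∈i x∈j with Packing.pruned Q j x∈j
    ... | t , t∈ , x≼t = x∈p─q⇒x∉q term (below v) t∈ (∈select⁺ (v ≼?_) (≼-trans (P-below i x∈i) x≼t))

  PackingAt : Vertex → Subset (suc n) → Set
  PackingAt v term = ∃[ k ] Σ (Packing (Fin k) term ⁅ v ⁆) (Below v)

  leafPacking : 1 ≤ κ → ∀ {v term} → IsLeaf T v → v ∈ term → (∀ {t} → t ∈ term → v ≼ t) → PackingAt v term
  leafPacking 1≤κ {v} {term} leaf v∈ below-v = 1 , packing , λ _ x∈ → v≼ x∈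
    where
    v≼ : ∀ {x} → x ∈ ⁅ v ⁆ → v ≼ x
    v≼ x∈ with x∈⁅y⁆⇒x≡y v x∈
    ... | refl = ≼-refl

    singleton : Subtree T
    singleton = record
      { verts   = ⁅ v ⁆
      ; root    = v
      ; root∈   = x∈⁅x⁆ v
      ; closed₀ = x∈⁅y⁆⇒x≡y v
      ; closedₛ = λ i i∈ i≢v → ⊥-elim (i≢v (x∈⁅y⁆⇒x≡y v i∈))
      }

    packing : Packing (Fin 1) term ⁅ v ⁆
    packing = record
      { tree          = λ _ → singleton
      ; edge-disjoint = λ { zero zero 0≢0 → ⊥-elim (0≢0 refl) }
      ; root∈C        = λ _ → x∈⁅x⁆ v
      ; cover         = λ t t∈ → zero , subst (_∈ ⁅ v ⁆) (sym (≼-leaf leaf (below-v t∈))) (x∈⁅x⁆ v) , λ { zero _ → refl }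
      ; capacity      = λ _ → ℕ.≤-trans (∣p∩q∣≤∣p∣ ⁅ v ⁆ term) (subst (_≤ κ) (sym (∣⁅x⁆∣≡1 v)) 1≤κ)
      ; pruned        = λ _ x∈ → v , v∈ , subst (_≼ v) (sym (x∈⁅y⁆⇒x≡y v x∈)) ≼-refl
      }

  branchPacking : ∀ {v term} → v ∉ term → HasTerminalBelow term v → (∀ {t} → t ∈ term → v ≼ t)
                → (∀ {w} → ChildOf v w → ∣ term ∩ below w ∣ ≤ κ) → PackingAt v term
  branchPacking {v} {term} v∉ v-above below-v light = suc n , packing , λ w → inBranch⇒v≼ ∘ ∈select⁻ (inBranch? w)
    where
    open Branches v term

    edge-disjoint : ∀ w w′ → w ≢ w′ → ∀ e → ¬ (EdgeIn (branch w) e × EdgeIn (branch w′) e)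
    edge-disjoint w w′ w≢w′ e ((e∈w , e≢v) , (e∈w′ , _))
      with ∈select⁻ (inBranch? w) e∈w | ∈select⁻ (inBranch? w′) e∈w′
    ... | inj₁ e≡v | _ = e≢v e≡v
    ... | inj₂ _ | inj₁ e≡v = e≢v e≡v
    ... | inj₂ (w-child , w≼e , _) | inj₂ (w′-child , w′≼e , _) = w≢w′ (child-unique w-child w′-child w≼e w′≼e)

    cover : ∀ t → t ∈ term → ∃[ w ] t ∈ verts (branch w) × (∀ w′ → t ∈ verts (branch w′) → w′ ≡ w)
    cover t t∈ with child-on-path (below-v t∈) (λ t≡v → v∉ (subst (_∈ term) t≡v t∈))
    ... | w , w-child , w≼t = w , ∈select⁺ (inBranch? w) (inj₂ (w-child , w≼t , t , t∈ , ≼-refl)) , unique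
      where
      unique : ∀ w′ → t ∈ verts (branch w′) → w′ ≡ w
      unique w′ t∈w′ with ∈select⁻ (inBranch? w′) t∈w′
      ... | inj₁ refl = ⊥-elim (v∉ t∈)
      ... | inj₂ (w′-child , w′≼t , _) = child-unique w′-child w-child w′≼t w≼t

    capacity : ∀ w → Dec (ChildOf v w) → termCount term (branch w) ≤ κ
    capacity w (yes w-child) = ℕ.≤-trans (∣p∩q∣≤∣r∩s∣ in-below) (light w-child)
      where
      in-below : ∀ {x} → x ∈ verts (branch w) → x ∈ term → x ∈ term × x ∈ below w
      in-below x∈w x∈ with ∈select⁻ (inBranch? w) x∈w
      ... | inj₁ refl = ⊥-elim (v∉ x∈)
      ... | inj₂ (_ , w≼x , _) = x∈ , ∈select⁺ (w ≼?_) w≼x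
    capacity w (no ¬w-child) = ℕ.≤-trans (ℕ.≤-reflexive (Empty⇒∣p∣≡0 none)) z≤n
      where
      none : Empty (verts (branch w) ∩ term)
      none (x , x∈) with x∈p∩q⁻ (verts (branch w)) term x∈
      ... | x∈w , x∈t with ∈select⁻ (inBranch? w) x∈w
      ...   | inj₁ refl = v∉ x∈t
      ...   | inj₂ (w-child , _) = ¬w-child w-child

    pruned : ∀ w {x} → x ∈ verts (branch w) → HasTerminalBelow term x
    pruned w x∈w with ∈select⁻ (inBranch? w) x∈w
    ... | inj₁ refl = v-above
    ... | inj₂ (_ , _ , x-above) = x-above

    packing : Packing (Fin (suc n)) term ⁅ v ⁆
    packing = record
      { tree          = branch
      ; edge-disjoint = edge-disjoint
      ; root∈C        = λ _ → x∈⁅x⁆ v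
      ; cover         = cover
      ; capacity      = λ w → capacity w (childOf? v w)
      ; pruned        = pruned
      }

module Greedy {n : ℕ} (T : RootedTree n) (φ : ℕ) where
  open Ancestry T
  open Packings T (suc φ)

  Leafy : Subset (suc n) → Set
  Leafy term = ∀ v → v ∈ term → IsLeaf T v

  Heavy : Subset (suc n) → Vertex → Set
  Heavy term v = suc φ ≤ ∣ term ∩ below v ∣ ⊎ term ⊆ below v

  heavy? : ∀ term → Decidable (Heavy term)
  heavy? term v = (suc φ ≤? ∣ term ∩ below v ∣) ⊎-dec (term ⊆? below v)

  root-heavy : ∀ term → Heavy term zero
  root-heavy term = inj₂ λ {x} _ → ∈select⁺ (zero ≼?_) (zero≼ x)

  Solution : Subset (suc n) → Set
  Solution term = ∃[ C ] ∃[ k ] Packing (Fin k) term C × ∣ C ∣ ≤ ⌈ ∣ term ∣ / suc φ ⌉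

  emptySolution : ∀ {term} → Empty term → Solution term
  emptySolution {term} empty = ∅ , 0 , packing , subst (_≤ ⌈ ∣ term ∣ / suc φ ⌉) (sym (∣⊥∣≡0 (suc n))) z≤n
    where
    packing : Packing (Fin 0) term ∅
    packing = record
      { tree          = λ ()
      ; edge-disjoint = λ ()
      ; root∈C        = λ ()
      ; cover         = λ t t∈ → ⊥-elim (empty (t , t∈))
      ; capacity      = λ ()
      ; pruned        = λ ()
      }

  extend : ∀ {term} v → Nonempty (term ∩ below v) → suc φ ≤ ∣ term ∩ below v ∣ ⊎ ∣ term ─ below v ∣ ≡ 0
         → PackingAt v (term ∩ below v) → Solution (term ─ below v) → Solution term
  extend {term} v local≢∅ split (k₀ , P , P-below) (C , k , Q , Q-bound) =
    ⁅ v ⁆ ∪ C , k₀ + k , reindex +↔⊎ (attach v P P-below Q) , bound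
    where
    open ℕ.≤-Reasoning
    bound : ∣ ⁅ v ⁆ ∪ C ∣ ≤ ⌈ ∣ term ∣ / suc φ ⌉
    bound = begin
      ∣ ⁅ v ⁆ ∪ C ∣                                        ≤⟨ ∣p∪q∣≤∣p∣+∣q∣ ⁅ v ⁆ C ⟩
      ∣ ⁅ v ⁆ ∣ + ∣ C ∣                                    ≡⟨ cong (_+ ∣ C ∣) (∣⁅x⁆∣≡1 v) ⟩
      suc ∣ C ∣                                            ≤⟨ s≤s Q-bound ⟩
      suc ⌈ ∣ term ─ below v ∣ / suc φ ⌉                   ≤⟨ ⌈m/n⌉-split _ _ (suc φ) (Nonempty⇒∣p∣>0 local≢∅) split ⟩
      ⌈ ∣ term ∩ below v ∣ + ∣ term ─ below v ∣ / suc φ ⌉  ≡⟨ cong (λ m → ⌈ m / suc φ ⌉) (∣p∩q∣+∣p─q∣≡∣p∣ term (below v)) ⟩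
      ⌈ ∣ term ∣ / suc φ ⌉                                 ∎

  module HeavyVertex {term} (leafy : Leafy term) (term≢∅ : Nonempty term) where

    local⇒below : ∀ v {t} → t ∈ term ∩ below v → v ≼ t
    local⇒below v t∈ = ∈select⁻ (v ≼?_) (proj₂ (x∈p∩q⁻ term (below v) t∈))

    local≢∅ : ∀ v → Heavy term v → Nonempty (term ∩ below v)
    local≢∅ _ (inj₁ c≤local) = ∣p∣>0⇒Nonempty (ℕ.≤-trans (s≤s z≤n) c≤local)
    local≢∅ _ (inj₂ term⊆v)  = let (t , t∈) = term≢∅ in t , x∈p∩q⁺ (t∈ , term⊆v t∈)

    heavy-split : ∀ v → Heavy term v → suc φ ≤ ∣ term ∩ below v ∣ ⊎ ∣ term ─ below v ∣ ≡ 0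
    heavy-split _ (inj₁ c≤local) = inj₁ c≤local
    heavy-split v (inj₂ term⊆v)  =
      inj₂ (Empty⇒∣p∣≡0 λ (t , t∈) → x∈p─q⇒x∉q term (below v) t∈ (term⊆v (p─q⊆p term (below v) t∈)))

    packingAt : ∀ v → Heavy term v → (∀ y → toℕ v < toℕ y → ¬ Heavy term y) → PackingAt v (term ∩ below v)
    packingAt v v-heavy deeper-light with v ∈? term
    ... | yes v∈ = leafPacking (s≤s z≤n) (leafy v v∈) (x∈p∩q⁺ (v∈ , ∈select⁺ (v ≼?_) ≼-refl)) (local⇒below v)
    ... | no v∉  = branchPacking (v∉ ∘ proj₁ ∘ x∈p∩q⁻ term (below v)) v-above (local⇒below v) light
      where
      v-above : HasTerminalBelow (term ∩ below v) v
      v-above = let (t , t∈) = local≢∅ v v-heavy in t , t∈ , local⇒below v t∈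
      light : ∀ {w} → ChildOf v w → ∣ (term ∩ below v) ∩ below w ∣ ≤ suc φ
      light {w} w-child = ℕ.≤-trans (∣p∩q∣≤∣r∩s∣ λ x∈ x∈w → proj₁ (x∈p∩q⁻ term (below v) x∈) , x∈w)
        (ℕ.<⇒≤ (ℕ.≰⇒> λ w-large → deeper-light w (child⇒toℕ< w-child) (inj₁ w-large)))

  solution : ∀ term → Leafy term → Solution term
  solution = All.wfRec (On.wellFounded ∣_∣ <-wellFounded) 0ℓ (λ term → Leafy term → Solution term) solve
    where
    solve : ∀ term → WfRec (_<_ on ∣_∣) (λ term → Leafy term → Solution term) term → Leafy term → Solution term
    solve term recurse leafy with nonempty? term
    ... | no term≡∅ = emptySolution term≡∅
    ... | yes term≢∅ with greatest (heavy? term) {zero} (root-heavy term)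
    ...   | v , v-heavy , deeper-light =
      extend v (local≢∅ v v-heavy) (heavy-split v v-heavy) (packingAt v v-heavy deeper-light)
        (recurse (p∩q≢∅⇒∣p─q∣<∣p∣ term (below v) (local≢∅ v v-heavy)) λ t t∈ → leafy t (p─q⊆p term (below v) t∈))
      where open HeavyVertex leafy term≢∅

lemma7 : {n : ℕ} (T : RootedTree n) (term : Subset (suc n))
    → ((v : Fin (suc n)) → v ∈ term → IsLeaf T v)
    → (φ : ℕ)
    → Σ (Subset (suc n)) λ C → IsCore T term (suc φ) C × (∣ C ∣ ≤ ⌈ ∣ term ∣ / suc φ ⌉)
lemma7 T term leafy φ with Greedy.solution T φ term leafy
... | C , k , packing , bound = C , Packings.packing⇒core T (suc φ) packing , bound
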